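{- Let $\mathcal P_1,\dots,\mathcal P_m$ be induced-hereditary hypergraph properties, and let $G$ be a $\mathcal P_1\circ\cdots\circ\mathcal P_m$-strict hypergraph. Then for every $(\mathcal P_1,\dots,\mathcal P_m)$-partition $(V_1,\dots,V_m)$ of $V(G)$, each $G[V_i]$ is $\mathcal P_i$-strict (and in particular non-empty).
   Context: All hypergraphs are finite, without loops or multiple edges; each edge is an ordered tuple $(v_1,\dots,v_r;c)$ of $r\ge 2$ distinct vertices together with a colour $c$, and isomorphisms must preserve the order and colour of edges. For $U\subseteq V(H)$, $H[U]$ is the hypergraph on $U$ whose edges are those edges of $H$ all of whose vertices lie in $U$; $G\le H$ means $G$ is isomorphic to $H[U]$ for some $U$. A property is a nonempty isomorphism-closed class of hypergraphs; the null hypergraph $K_0$ is regarded as belonging to every property. A property is induced-hereditary if closed under $\le$. A $(\mathcal P_1,\dots,\mathcal P_m)$-partition of $H$ is a partition $(V_1,\dots,V_m)$ of $V(H)$ into possibly empty parts with $H[V_i]\in\mathcal P_i$; $\mathcal P_1\circ\cdots\circ\mathcal P_m$ is the class of hypergraphs having such a partition. For hypergraphs $G_1,G_2$ on disjoint vertex sets, $G_1*G_2$ is the set of all hypergraphs $H$ with $V(H)=V(G_1)\cup V(G_2)$ and $H[V(G_i)]=G_i$; $K_1$ is the one-vertex hypergraph. For a property $\mathcal Q$, a hypergraph $G$ is $\mathcal Q$-strict if $G\in\mathcal Q$ but $G*K_1\not\subseteq\mathcal Q$. -}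

module Defs where

open import Data.Nat using (ℕ; zero; suc; _≤_; _<_)
open import Data.Fin using (Fin)
open import Data.Vec using (Vec; lookup)
import Data.Vec as Vec
open import Data.List using (List)
open import Data.List.Membership.Propositional using (_∈_)
open import Data.List.Relation.Unary.All using (All)
open import Data.List.Relation.Unary.Unique.Propositional using (Unique)
open import Data.Product using (Σ; _×_; ∃)
open import Relation.Binary.PropositionalEquality using (_≡_; _≢_)
open import Relation.Nullary using (¬_)
open import Function.Definitions using (Injective; Bijective)

-- Hypergraphs with colours drawn from a type C.
-- Vertex set of a hypergraph of order n is Fin n.
-- An edge is an ordered tuple (v₁,…,v_r) together with a colour c.

record HEdge (n : ℕ) (C : Set) : Set where
  constructor mkEdge
  field
    arity  : ℕ
    verts  : Vec (Fin n) arity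
    colour : C
open HEdge public

Distinct : ∀ {n r} → Vec (Fin n) r → Set
Distinct vs = ∀ i j → lookup vs i ≡ lookup vs j → i ≡ j

WellFormed : ∀ {n C} → HEdge n C → Set
WellFormed e = 2 ≤ arity e × Distinct (verts e)

record Hypergraph (C : Set) : Set where
  constructor mkHypergraph
  field
    order        : ℕ
    edges        : List (HEdge order C)
    edges-unique : Unique edges
    edges-wf     : All WellFormed edges
open Hypergraph public

mapEdge : ∀ {m n C} → (Fin m → Fin n) → HEdge m C → HEdge n C
mapEdge f (mkEdge r vs c) = mkEdge r (Vec.map f vs) c

EdgeCompatible : ∀ {C} (K G : Hypergraph C) → (Fin (order K) → Fin (order G)) → Set
EdgeCompatible K G f =
  ∀ e → (e ∈ edges K → mapEdge f e ∈ edges G) × (mapEdge f e ∈ edges G → e ∈ edges K)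

_≅_ : ∀ {C} → Hypergraph C → Hypergraph C → Set
K ≅ G = Σ (Fin (order K) → Fin (order G)) λ f → Bijective _≡_ _≡_ f × EdgeCompatible K G f

-- K ≤ G : K is isomorphic to an induced subhypergraph of G
_≤ᵢ_ : ∀ {C} → Hypergraph C → Hypergraph C → Set
K ≤ᵢ G = Σ (Fin (order K) → Fin (order G)) λ f → Injective _≡_ _≡_ f × EdgeCompatible K G f

-- "K (via f) is the induced subhypergraph G[U]":
-- f is an edge-compatible injection whose image is exactly U.
-- (G[U] is thereby determined up to isomorphism.)
IsInduced : ∀ {C} (G : Hypergraph C) (U : Fin (order G) → Set)
            (K : Hypergraph C) → (Fin (order K) → Fin (order G)) → Set
IsInduced G U K f =
  Injective _≡_ _≡_ f × EdgeCompatible K G f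
  × (∀ x → U (f x)) × (∀ v → U v → ∃ λ x → f x ≡ v)

record Property (C : Set) : Set₁ where
  field
    Mem        : Hypergraph C → Set
    iso-closed : ∀ {G H} → G ≅ H → Mem G → Mem H
    null-mem   : ∀ G → order G ≡ 0 → Mem G
open Property public

InducedHereditary : ∀ {C} → Property C → Set
InducedHereditary P = ∀ {G H} → G ≤ᵢ H → Mem P H → Mem P G

InducedIn : ∀ {C} (G : Hypergraph C) (U : Fin (order G) → Set) → (Hypergraph C → Set) → Set
InducedIn {C} G U Q =
  Σ (Hypergraph C) λ K → Σ (Fin (order K) → Fin (order G)) λ f → IsInduced G U K f × Q K

-- a partition (V₁,…,V_m) of V(G) into possibly empty parts, given by
-- assigning to each vertex the index of its part
Part : ∀ {C m} (G : Hypergraph C) → (Fin (order G) → Fin m) → Fin m → Fin (order G) → Set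
Part G part i v = part v ≡ i

IsPartitionFor : ∀ {C m} → (Fin m → Property C) → (G : Hypergraph C) → (Fin (order G) → Fin m) → Set
IsPartitionFor Ps G part = ∀ i → InducedIn G (Part G part i) (Mem (Ps i))

Comp : ∀ {C m} → (Fin m → Property C) → Hypergraph C → Set
Comp {m = m} Ps G = Σ (Fin (order G) → Fin m) λ part → IsPartitionFor Ps G part

-- H ∈ G * K₁ (up to the naming of vertices): H has exactly one vertex w
-- outside an induced copy of G
InStarK₁ : ∀ {C} → Hypergraph C → Hypergraph C → Set
InStarK₁ G H =
  Σ (Fin (order G) → Fin (order H)) λ f → Σ (Fin (order H)) λ w →
    IsInduced H (λ v → v ≢ w) G f

Strict : ∀ {C} → (Hypergraph C → Set) → Hypergraph C → Set
Strict Q G = Q G × ¬ (∀ H → InStarK₁ G H → Q H)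

{-# OPTIONS --safe #-}
module Submission where

-- Suppose every one-vertex extension of K = G[Vᵢ] lay in Pᵢ. Given a one-vertex extension G + w of G,
-- put w into the i-th part: for j ≠ i the j-th part is G[Vⱼ] again, and the i-th part is a one-vertex
-- extension of K, so G + w ∈ P₁ ∘ ⋯ ∘ Pₘ, contradicting strictness of G; heredity gives K ∈ Pᵢ.
-- If Vᵢ were empty, every one-vertex extension of K would be a single vertex, which lies in Pᵢ by
-- heredity as soon as Pᵢ has a non-null member.

open import Defs

open import Data.Nat using (ℕ; _<_; s≤s)
open import Data.Fin using (Fin; zero; suc; _≟_; fromℕ<)
open import Data.Fin.Properties using (any?)
open import Data.Product using (Σ; _×_; ∃; _,_; proj₁; proj₂)
open import Data.Maybe using (Maybe; just; nothing)
import Data.Maybe as Maybe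
open import Data.List using (List; []; _∷_; filter; allFin; length; mapMaybe)
import Data.List as List
open import Data.Vec using (Vec; lookup)
import Data.Vec as Vec
open import Data.Vec.Properties using (map-∘; map-cong; lookup-map)
open import Data.List.Membership.Propositional using (_∈_)
open import Data.List.Membership.Propositional.Properties
  using (∈-filter⁺; ∈-filter⁻; ∈-allFin; ∈-lookup)
open import Data.List.Relation.Unary.Any using (here; there; index)
open import Data.List.Relation.Unary.Any.Properties using (lookup-index)
import Data.List.Relation.Unary.All as All
open import Data.List.Relation.Unary.AllPairs using ([]; _∷_)
open import Data.List.Relation.Unary.Unique.Propositional using (Unique)
open import Data.List.Relation.Unary.Unique.Propositional.Properties using (filter⁺; allFin⁺)
open import Data.Empty using (⊥-elim)
open import Function using (_∘_; id)
open import Function.Definitions using (Injective)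
open import Level using (0ℓ)
open import Relation.Binary.PropositionalEquality using (_≡_; _≢_; refl; sym; trans; cong; cong₂; subst)
open import Relation.Nullary using (¬_; yes; no)
open import Relation.Unary using (Pred; Decidable; _⊆_)

private
  variable
    C : Set
    a b c n k : ℕ

lookup-injective : {A : Set} {xs : List A} → Unique xs → Injective _≡_ _≡_ (List.lookup xs)
lookup-injective {xs = x ∷ xs} _          {zero}  {zero}  _  = refl
lookup-injective {xs = x ∷ xs} (x∉xs ∷ _) {zero}  {suc j} eq = ⊥-elim (All.lookup x∉xs (∈-lookup j) eq)
lookup-injective {xs = x ∷ xs} (x∉xs ∷ _) {suc i} {zero}  eq = ⊥-elim (All.lookup x∉xs (∈-lookup i) (sym eq))
lookup-injective {xs = x ∷ xs} (_ ∷ u)    {suc i} {suc j} eq = cong suc (lookup-injective u eq)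

module _ {A B : Set} (h : A → Maybe B) where

  ∈-mapMaybe⁻ : ∀ xs {y} → y ∈ mapMaybe h xs → ∃ λ x → x ∈ xs × h x ≡ just y
  ∈-mapMaybe⁻ (x ∷ xs) y∈ with h x in hx
  ... | nothing = let x′ , x′∈ , hx′ = ∈-mapMaybe⁻ xs y∈ in x′ , there x′∈ , hx′
  ... | just _ with y∈
  ...   | here refl = x , here refl , hx
  ...   | there y∈′ = let x′ , x′∈ , hx′ = ∈-mapMaybe⁻ xs y∈′ in x′ , there x′∈ , hx′

  ∈-mapMaybe⁺ : ∀ {xs x y} → x ∈ xs → h x ≡ just y → y ∈ mapMaybe h xs
  ∈-mapMaybe⁺ {x ∷ xs} (here refl) hx rewrite hx = here refl
  ∈-mapMaybe⁺ {x ∷ xs} (there x∈) hy with h x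
  ... | nothing = ∈-mapMaybe⁺ x∈ hy
  ... | just _  = there (∈-mapMaybe⁺ x∈ hy)

  mapMaybe-unique : (∀ {x x′ y} → h x ≡ just y → h x′ ≡ just y → x ≡ x′)
                  → ∀ {xs} → Unique xs → Unique (mapMaybe h xs)
  mapMaybe-unique h-inj {[]}     []           = []
  mapMaybe-unique h-inj {x ∷ xs} (x∉xs ∷ u) with h x in hx
  ... | nothing = mapMaybe-unique h-inj u
  ... | just y  = All.tabulate y∉ ∷ mapMaybe-unique h-inj u
    where
    y∉ : ∀ {z} → z ∈ mapMaybe h xs → y ≢ z
    y∉ z∈ refl = let x′ , x′∈ , hx′ = ∈-mapMaybe⁻ xs z∈ in All.lookup x∉xs x′∈ (h-inj hx hx′)

mapEdge-∘ : (f : Fin b → Fin c) (g : Fin a → Fin b) (e : HEdge a C)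
          → mapEdge f (mapEdge g e) ≡ mapEdge (f ∘ g) e
mapEdge-∘ f g (mkEdge r vs c) = cong (λ ws → mkEdge r ws c) (sym (map-∘ f g vs))

mapEdge-cong : {f g : Fin a → Fin b} → (∀ x → f x ≡ g x) → (e : HEdge a C)
             → mapEdge f e ≡ mapEdge g e
mapEdge-cong f≗g (mkEdge r vs c) = cong (λ ws → mkEdge r ws c) (map-cong f≗g vs)

WellFormed-mapEdge⁻ : (f : Fin a → Fin b) (e : HEdge a C) → WellFormed (mapEdge f e) → WellFormed e
WellFormed-mapEdge⁻ f (mkEdge r vs c) (2≤r , distinct) =
  2≤r , λ i j eq → distinct i j (trans (lookup-map i f vs) (trans (cong f eq) (sym (lookup-map j f vs))))

¬WellFormed-constant : (e : HEdge n C) → (∀ i j → lookup (verts e) i ≡ lookup (verts e) j)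
                     → ¬ WellFormed e
¬WellFormed-constant e constant (s≤s (s≤s _) , distinct)
  with () ← distinct zero (suc zero) (constant zero (suc zero))

IsEmbedding : (A B : Hypergraph C) → (Fin (order A) → Fin (order B)) → Set
IsEmbedding A B f = Injective _≡_ _≡_ f × EdgeCompatible A B f

module _ {A B H : Hypergraph C} where

  ∘-isEmbedding : ∀ {g f} → IsEmbedding B H g → IsEmbedding A B f → IsEmbedding A H (g ∘ f)
  ∘-isEmbedding {g} {f} (g-inj , g-compat) (f-inj , f-compat) = f-inj ∘ g-inj , compat
    where
    compat : EdgeCompatible A H (g ∘ f)
    compat e = (λ e∈A → subst (_∈ edges H) (mapEdge-∘ g f e) (proj₁ (g-compat _) (proj₁ (f-compat e) e∈A)))
             , (λ e∈H → proj₂ (f-compat e) (proj₂ (g-compat _) (subst (_∈ edges H) (sym (mapEdge-∘ g f e)) e∈H)))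

  factor-isEmbedding : ∀ {f g} → IsEmbedding A H f → IsEmbedding B H g
                     → (∀ x → ∃ λ y → g y ≡ f x)
                     → Σ (Fin (order A) → Fin (order B)) λ h → IsEmbedding A B h × (∀ x → g (h x) ≡ f x)
  factor-isEmbedding {f} {g} (f-inj , f-compat) (g-inj , g-compat) preimage =
    h , (h-inj , h-compat) , g∘h≗f
    where
    h = proj₁ ∘ preimage
    g∘h≗f : ∀ x → g (h x) ≡ f x
    g∘h≗f = proj₂ ∘ preimage
    h-inj : Injective _≡_ _≡_ h
    h-inj {x} {y} eq = f-inj (trans (sym (g∘h≗f x)) (trans (cong g eq) (g∘h≗f y)))
    image : ∀ e → mapEdge g (mapEdge h e) ≡ mapEdge f e
    image e = trans (mapEdge-∘ g h e) (mapEdge-cong g∘h≗f e)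
    h-compat : EdgeCompatible A B h
    h-compat e = (λ e∈A → proj₂ (g-compat _) (subst (_∈ edges H) (sym (image e)) (proj₁ (f-compat e) e∈A)))
               , (λ e∈B → proj₂ (f-compat e) (subst (_∈ edges H) (image e) (proj₁ (g-compat _) e∈B)))

≤ᵢ-subsingleton : {A B : Hypergraph C} → (∀ (x y : Fin (order A)) → x ≡ y) → Fin (order B) → A ≤ᵢ B
≤ᵢ-subsingleton {A = A} {B} subsingleton v = (λ _ → v) , (λ {x} {y} _ → subsingleton x y) , compat
  where
  compat : EdgeCompatible A B (λ _ → v)
  compat e = (λ e∈A → ⊥-elim (¬WellFormed-constant e (λ i j → subsingleton _ _) (All.lookup (edges-wf A) e∈A)))
           , (λ e∈B → ⊥-elim (¬WellFormed-constant (mapEdge (λ _ → v) e) (constant e) (All.lookup (edges-wf B) e∈B)))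
    where
    constant : ∀ e i j → lookup (verts (mapEdge (λ _ → v) e)) i ≡ lookup (verts (mapEdge (λ _ → v) e)) j
    constant (mkEdge _ vs _) i j = trans (lookup-map i _ vs) (sym (lookup-map j _ vs))

module _ {G K : Hypergraph C} {f : Fin (order K) → Fin (order G)} where

  IsInduced-resp : {U U′ : Pred (Fin (order G)) 0ℓ} → U ⊆ U′ → U′ ⊆ U
                 → IsInduced G U K f → IsInduced G U′ K f
  IsInduced-resp U⊆U′ U′⊆U (f-inj , f-compat , f∈U , onto-U) =
    f-inj , f-compat , U⊆U′ ∘ f∈U , λ v → onto-U v ∘ U′⊆U

module _ {H A B : Hypergraph C} {U U′ : Pred (Fin (order H)) 0ℓ}
         {f : Fin (order A) → Fin (order H)} {g : Fin (order B) → Fin (order H)} where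

  induced-factor : IsInduced H U A f → IsInduced H U′ B g → U ⊆ U′
                 → Σ (Fin (order A) → Fin (order B)) λ h → IsInduced B (U ∘ g) A h
  induced-factor (f-inj , f-compat , f∈U , onto-U) (g-inj , g-compat , _ , onto-U′) U⊆U′
    with factor-isEmbedding {A = A} {B} {H} (f-inj , f-compat) (g-inj , g-compat)
                            (λ x → onto-U′ (f x) (U⊆U′ (f∈U x)))
  ... | h , (h-inj , h-compat) , g∘h≗f = h , h-inj , h-compat , h∈ , onto
    where
    h∈ : ∀ x → U (g (h x))
    h∈ x = subst U (sym (g∘h≗f x)) (f∈U x)
    onto : ∀ y → U (g y) → ∃ λ x → h x ≡ y
    onto y gy∈U = let x , fx≡gy = onto-U (g y) gy∈U in x , g-inj (trans (g∘h≗f x) fx≡gy)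

  induced-≤ᵢ : IsInduced H U A f → IsInduced H U′ B g → U ⊆ U′ → A ≤ᵢ B
  induced-≤ᵢ A-ind B-ind U⊆U′ =
    let h , h-inj , h-compat , _ = induced-factor A-ind B-ind U⊆U′ in h , h-inj , h-compat

-- An edge of H lies in the image of ι exactly when all of its vertices do, and then
-- pulling it back vertex by vertex along the partial inverse ι⁻¹ recovers its preimage.
module PullBack {C : Set} (ι : Fin k → Fin n) (ι⁻¹ : Fin n → Maybe (Fin k))
  (ι⁻¹-sound : ∀ {v x} → ι⁻¹ v ≡ just x → ι x ≡ v) (ι⁻¹-ι : ∀ x → ι⁻¹ (ι x) ≡ just x) where

  pullVec : ∀ {r} → Vec (Fin n) r → Maybe (Vec (Fin k) r)
  pullVec Vec.[]       = just Vec.[]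
  pullVec (v Vec.∷ vs) = Maybe.zipWith Vec._∷_ (ι⁻¹ v) (pullVec vs)

  pullVec-sound : ∀ {r} (vs : Vec (Fin n) r) {xs} → pullVec vs ≡ just xs → Vec.map ι xs ≡ vs
  pullVec-sound Vec.[]       refl = refl
  pullVec-sound (v Vec.∷ vs) eq with ι⁻¹ v in ι⁻¹v | pullVec vs in pullVs
  ... | just x  | just xs with refl ← eq = cong₂ Vec._∷_ (ι⁻¹-sound ι⁻¹v) (pullVec-sound vs pullVs)
  ... | just _  | nothing with () ← eq
  ... | nothing | _       with () ← eq

  pullVec-map : ∀ {r} (xs : Vec (Fin k) r) → pullVec (Vec.map ι xs) ≡ just xs
  pullVec-map Vec.[]       = refl
  pullVec-map (x Vec.∷ xs) rewrite ι⁻¹-ι x | pullVec-map xs = refl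

  pullEdge : HEdge n C → Maybe (HEdge k C)
  pullEdge (mkEdge r vs c) = Maybe.map (λ xs → mkEdge r xs c) (pullVec vs)

  pullEdge-sound : ∀ (e : HEdge n C) {e′} → pullEdge e ≡ just e′ → mapEdge ι e′ ≡ e
  pullEdge-sound (mkEdge r vs c) eq with pullVec vs in pullVs
  ... | just xs with refl ← eq = cong (λ ws → mkEdge r ws c) (pullVec-sound vs pullVs)

  pullEdge-mapEdge : ∀ (e : HEdge k C) → pullEdge (mapEdge ι e) ≡ just e
  pullEdge-mapEdge (mkEdge r xs c) rewrite pullVec-map xs = refl

module _ {C : Set} (H : Hypergraph C) {U : Pred (Fin (order H)) 0ℓ} (U? : Decidable U) where

  private
    inU : List (Fin (order H))
    inU = filter U? (allFin (order H))

    ι : Fin (length inU) → Fin (order H)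
    ι = List.lookup inU

    ι-injective : Injective _≡_ _≡_ ι
    ι-injective = lookup-injective (filter⁺ U? (allFin⁺ _))

    ι⁻¹ : Fin (order H) → Maybe (Fin (length inU))
    ι⁻¹ v with any? (λ x → ι x ≟ v)
    ... | yes (x , _) = just x
    ... | no _        = nothing

    ι⁻¹-sound : ∀ {v x} → ι⁻¹ v ≡ just x → ι x ≡ v
    ι⁻¹-sound {v} eq with any? (λ x → ι x ≟ v)
    ... | yes (_ , ιx≡v) with refl ← eq = ιx≡v

    ι⁻¹-ι : ∀ x → ι⁻¹ (ι x) ≡ just x
    ι⁻¹-ι x with any? (λ y → ι y ≟ ι x)
    ... | yes (_ , ιy≡ιx) = cong just (ι-injective ιy≡ιx)
    ... | no ∄y           = ⊥-elim (∄y (x , refl))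

    open PullBack {C = C} ι ι⁻¹ ι⁻¹-sound ι⁻¹-ι

    pullEdge-injective : ∀ {e e′ e″} → pullEdge e ≡ just e″ → pullEdge e′ ≡ just e″ → e ≡ e′
    pullEdge-injective p p′ = trans (sym (pullEdge-sound _ p)) (pullEdge-sound _ p′)

    K : Hypergraph C
    K = mkHypergraph (length inU) (mapMaybe pullEdge (edges H))
          (mapMaybe-unique pullEdge pullEdge-injective (edges-unique H))
          (All.tabulate wf)
      where
      wf : ∀ {e} → e ∈ mapMaybe pullEdge (edges H) → WellFormed e
      wf {e} e∈ = let e′ , e′∈H , pe′ = ∈-mapMaybe⁻ pullEdge (edges H) e∈ in
        WellFormed-mapEdge⁻ ι e (subst WellFormed (sym (pullEdge-sound e′ pe′)) (All.lookup (edges-wf H) e′∈H))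

    ι-compat : EdgeCompatible K H ι
    ι-compat e = (λ e∈ → let e′ , e′∈H , pe′ = ∈-mapMaybe⁻ pullEdge (edges H) e∈ in
                           subst (_∈ edges H) (sym (pullEdge-sound e′ pe′)) e′∈H)
               , (λ ιe∈H → ∈-mapMaybe⁺ pullEdge ιe∈H (pullEdge-mapEdge e))

    ι∈U : ∀ x → U (ι x)
    ι∈U x = proj₂ (∈-filter⁻ U? {xs = allFin _} (∈-lookup x))

    onto-U : ∀ v → U v → ∃ λ x → ι x ≡ v
    onto-U v v∈U = let v∈inU = ∈-filter⁺ U? (∈-allFin v) v∈U in index v∈inU , sym (lookup-index v∈inU)

  induced : Σ (Hypergraph C) λ K → Σ (Fin (order K) → Fin (order H)) λ f → IsInduced H U K f
  induced = K , ι , ι-injective , ι-compat , ι∈U , onto-U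

empty-not-strict : {P : Property C} → InducedHereditary P → ∀ {H K}
                 → Mem P H → Fin (order H) → ¬ Fin (order K) → ¬ Strict (Mem P) K
empty-not-strict {P = P} hereditary {H} {K} H∈P v K-empty (_ , ¬star⊆P) = ¬star⊆P star⊆P
  where
  star⊆P : ∀ H′ → InStarK₁ K H′ → Mem P H′
  star⊆P H′ (_ , w , _ , _ , _ , onto) =
    hereditary (≤ᵢ-subsingleton {A = H′} {H} (λ x y → trans (≡w x) (sym (≡w y))) v) H∈P
    where
    ≡w : ∀ x → x ≡ w
    ≡w x with x ≟ w
    ... | yes x≡w = x≡w
    ... | no x≢w  = ⊥-elim (K-empty (proj₁ (onto x x≢w)))

module Extension {C : Set} {G H : Hypergraph C} {g : Fin (order G) → Fin (order H)} {w : Fin (order H)}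
  (G-in-H : IsInduced H (_≢ w) G g) {m : ℕ} (part : Fin (order G) → Fin m) (i : Fin m) where

  private
    g-isEmbedding : IsEmbedding G H g
    g-isEmbedding = proj₁ G-in-H , proj₁ (proj₂ G-in-H)

    g≢w : ∀ x → g x ≢ w
    g≢w = proj₁ (proj₂ (proj₂ G-in-H))

    onto : ∀ v → v ≢ w → ∃ λ x → g x ≡ v
    onto = proj₂ (proj₂ (proj₂ G-in-H))

  part⁺ : Fin (order H) → Fin m
  part⁺ v with v ≟ w
  ... | yes _   = i
  ... | no v≢w = part (proj₁ (onto v v≢w))

  part⁺-w : part⁺ w ≡ i
  part⁺-w with w ≟ w
  ... | yes _  = refl
  ... | no w≢w = ⊥-elim (w≢w refl)

  part⁺-g : ∀ x → part⁺ (g x) ≡ part x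
  part⁺-g x with g x ≟ w
  ... | yes gx≡w = ⊥-elim (g≢w x gx≡w)
  ... | no gx≢w  = cong part (proj₁ g-isEmbedding (proj₂ (onto (g x) gx≢w)))

  induced-transport : ∀ {j A a} → IsInduced G (Part G part j) A a
                    → IsInduced H (λ v → v ≢ w × part⁺ v ≡ j) A (g ∘ a)
  induced-transport {j} {A} {a} (a-inj , a-compat , a∈ , onto-a)
    with ∘-isEmbedding {A = A} {G} {H} g-isEmbedding (a-inj , a-compat)
  ... | ga-inj , ga-compat = ga-inj , ga-compat , (λ x → g≢w (a x) , trans (part⁺-g (a x)) (a∈ x)) , onto-ga
    where
    onto-ga : ∀ v → v ≢ w × part⁺ v ≡ j → ∃ λ x → g (a x) ≡ v
    onto-ga v (v≢w , part⁺v≡j) =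
      let y , gy≡v = onto v v≢w
          x , ax≡y = onto-a y (trans (sym (part⁺-g y)) (trans (cong part⁺ gy≡v) part⁺v≡j))
      in x , trans (cong g ax≡y) gy≡v

  part⁺-≤ᵢ : ∀ {j A a B b} → j ≢ i → IsInduced G (Part G part j) A a → IsInduced H (Part H part⁺ j) B b
           → B ≤ᵢ A
  part⁺-≤ᵢ {j} {A} {B = B} j≢i A-ind B-ind =
    induced-≤ᵢ {H = H} {B} {A} B-ind (induced-transport {A = A} A-ind) (λ part⁺v≡j → v≢w part⁺v≡j , part⁺v≡j)
    where
    v≢w : ∀ {v} → part⁺ v ≡ j → v ≢ w
    v≢w part⁺v≡j refl = j≢i (trans (sym part⁺v≡j) part⁺-w)

  part⁺-star : ∀ {A a B b} → IsInduced G (Part G part i) A a → IsInduced H (Part H part⁺ i) B b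
             → InStarK₁ A B
  part⁺-star {A} {B = B} {b} A-ind B-ind@(b-inj , _ , b∈ , onto-b)
    with induced-factor {H = H} {A} {B} (induced-transport {A = A} A-ind) B-ind proj₂
       | onto-b w part⁺-w
  ... | h , h-ind | w′ , bw′≡w = h , w′ , IsInduced-resp {G = B} {A} avoids-w′ b-avoids-w h-ind
    where
    avoids-w′ : ∀ {y} → b y ≢ w × part⁺ (b y) ≡ i → y ≢ w′
    avoids-w′ (by≢w , _) refl = by≢w bw′≡w
    b-avoids-w : ∀ {y} → y ≢ w′ → b y ≢ w × part⁺ (b y) ≡ i
    b-avoids-w {y} y≢w′ = (λ by≡w → y≢w′ (b-inj (trans by≡w (sym bw′≡w)))) , b∈ y

module _ {C : Set} {m : ℕ} {Ps : Fin m → Property C} (hereditary : ∀ i → InducedHereditary (Ps i))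
  {G : Hypergraph C} {part : Fin (order G) → Fin m} (partition : IsPartitionFor Ps G part)
  {i : Fin m} {K : Hypergraph C} {f : Fin (order K) → Fin (order G)}
  (K-ind : IsInduced G (Part G part i) K f) where

  star⊆Comp : (∀ H′ → InStarK₁ K H′ → Mem (Ps i) H′) → ∀ H → InStarK₁ G H → Comp Ps H
  star⊆Comp star⊆Pᵢ H (g , w , G-in-H) = part⁺ , partition⁺
    where
    open Extension {G = G} {H} G-in-H part i

    part⁺-member : ∀ j {Kⱼ fⱼ} → IsInduced H (Part H part⁺ j) Kⱼ fⱼ → Mem (Ps j) Kⱼ
    part⁺-member j {Kⱼ} Kⱼ-ind with j ≟ i | partition j
    ... | no j≢i   | Gⱼ , _ , Gⱼ-ind , Gⱼ∈Pⱼ = hereditary j (part⁺-≤ᵢ {A = Gⱼ} {B = Kⱼ} j≢i Gⱼ-ind Kⱼ-ind) Gⱼ∈Pⱼ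
    ... | yes refl | _                      = star⊆Pᵢ Kⱼ (part⁺-star {A = K} {B = Kⱼ} K-ind Kⱼ-ind)

    partition⁺ : IsPartitionFor Ps H part⁺
    partition⁺ j = let Kⱼ , fⱼ , Kⱼ-ind = induced H (λ v → part⁺ v ≟ j) in
      Kⱼ , fⱼ , Kⱼ-ind , part⁺-member j Kⱼ-ind

  part-strict : Strict (Comp Ps) G → Strict (Mem (Ps i)) K
  part-strict (_ , ¬star⊆Comp) with partition i
  ... | Gᵢ , _ , Gᵢ-ind , Gᵢ∈Pᵢ =
    hereditary i (induced-≤ᵢ {H = G} {K} {Gᵢ} K-ind Gᵢ-ind id) Gᵢ∈Pᵢ , ¬star⊆Comp ∘ star⊆Comp

lemma2 : {C : Set} {m : ℕ} (Ps : Fin m → Property C)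
           → (∀ i → InducedHereditary (Ps i))
           → (G : Hypergraph C) → Strict (Comp Ps) G
           → (part : Fin (order G) → Fin m) → IsPartitionFor Ps G part
           → ∀ i
           → (∀ K f → IsInduced G (Part G part i) K f → Strict (Mem (Ps i)) K)
             × ((Σ (Hypergraph C) λ H → Mem (Ps i) H × 0 < order H)
                → ∃ λ v → Part G part i v)
lemma2 Ps hereditary G G-strict part partition i = parts-strict , part-nonempty
  where
  parts-strict : ∀ K f → IsInduced G (Part G part i) K f → Strict (Mem (Ps i)) K
  parts-strict K f K-ind = part-strict {Ps = Ps} hereditary {G = G} partition {K = K} K-ind G-strict

  part-nonempty : (Σ (Hypergraph _) λ H → Mem (Ps i) H × 0 < order H) → ∃ λ v → Part G part i v
  part-nonempty (H , H∈Pᵢ , 0<∣H∣) with any? (λ v → part v ≟ i) | partition i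
  ... | yes v∈Vᵢ   | _ = v∈Vᵢ
  ... | no Vᵢ-empty | K , f , K-ind@(_ , _ , f∈Vᵢ , _) , _ =
    ⊥-elim (empty-not-strict {P = Ps i} (hereditary i) {H} {K} H∈Pᵢ (fromℕ< 0<∣H∣) (λ x → Vᵢ-empty (f x , f∈Vᵢ x))
                             (parts-strict K f K-ind))
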